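{- Let $\Phi$ be a formula over $R$ and $\Phi_1$ a subformula of $\Phi$. Then for any tuple $\tilde\alpha$ (of values of the variables of $\Phi$), $\Phi_1(\tilde\alpha)=0$ implies $\Phi(\tilde\alpha)=0$.
   Context: $E_3=\{0,1,2\}$. $R$ is the set of all functions $f(x_1,\ldots,x_n)$ from $E_3^n$ to $\{0,1\}$ such that $f(\tilde\alpha)=0$ for every $\tilde\alpha\in E_3^n\setminus\{1,2\}^n$. A formula over $R$ is an expression $g(\mathcal B_1,\ldots,\mathcal B_m)$ with $g\in R$ an $m$-ary function and each $\mathcal B_j$ a variable symbol or a formula over $R$; subformulas are defined in the usual way, and formulas are evaluated by superposition. -}

module Defs where

open import Data.Nat using (ℕ)
open import Data.Fin using (Fin; zero; suc)
open import Data.Bool using (Bool; true; false)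
open import Data.Product using (∃)
open import Relation.Binary.PropositionalEquality using (_≡_)

E₃ : Set
E₃ = Fin 3

-- An element of R of arity m: a function E₃^m → {0,1} (Bool, false = 0, true = 1)
-- that vanishes on every tuple having some coordinate equal to 0,
-- i.e. on every tuple outside {1,2}^m.
record R (m : ℕ) : Set where
  field
    fn     : (Fin m → E₃) → Bool
    vanish : (α : Fin m → E₃) → (∃ λ i → α i ≡ zero) → fn α ≡ false
open R public

toE₃ : Bool → E₃
toE₃ false = zero
toE₃ true  = suc zero

data Formula (n : ℕ) : Set where
  var : Fin n → Formula n
  app : (m : ℕ) → R m → (Fin m → Formula n) → Formula n

eval : ∀ {n} → Formula n → (Fin n → E₃) → E₃
eval (var i)     α = α i
eval (app m g B) α = toE₃ (fn g (λ j → eval (B j) α))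

data _⊑_ {n : ℕ} : Formula n → Formula n → Set where
  ⊑-refl : ∀ {Φ} → Φ ⊑ Φ
  ⊑-arg  : ∀ {Ψ m g B} (j : Fin m) → Ψ ⊑ B j → Ψ ⊑ app m g B

module Submission where

open import Defs
open import Data.Nat using (ℕ)
open import Data.Fin using (Fin; zero)
open import Data.Product using (_,_)
open import Relation.Binary.PropositionalEquality using (_≡_; cong)

eval-app-zero : ∀ {n m} (g : R m) (B : Fin m → Formula n) (α : Fin n → E₃) (j : Fin m) →
  eval (B j) α ≡ zero → eval (app m g B) α ≡ zero
eval-app-zero g B α j Bj≡0 = cong toE₃ (vanish g (λ k → eval (B k) α) (j , Bj≡0))

mainTheorem4 : {n : ℕ} (Φ Φ₁ : Formula n) → Φ₁ ⊑ Φ → (α : Fin n → E₃) →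
    eval Φ₁ α ≡ zero → eval Φ α ≡ zero
mainTheorem4 Φ .Φ ⊑-refl α Φ₁≡0 = Φ₁≡0
mainTheorem4 (app m g B) Φ₁ (⊑-arg j Φ₁⊑Bj) α Φ₁≡0 =
  eval-app-zero g B α j (mainTheorem4 (B j) Φ₁ Φ₁⊑Bj α Φ₁≡0)
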